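{- Let $n\ge1$, let $i,j,k\in\{0,\dots,n\}$ with $r:=i+j-k\ge0$. Then $C^k_{i,j}\in\mathbb{Z}_{\ge0}[\beta_1,\dots,\beta_n]$, and the number of its monomial terms counted with multiplicity (i.e. the sum of its coefficients) equals \[ r!\binom{i}{r}\binom{j}{r}. \]
   Context: Let $T\subset \mathrm{GL}_{n+1}$ be the diagonal torus acting on $\mathbb{P}^n$, with $H_T^*(\mathrm{pt})=\mathbb{Z}[t_1,\dots,t_{n+1}]$. For $0\le k\le n$ let $\sigma_k=[X_k]_T\in H_T^*(\mathbb{P}^n)$ be the equivariant class of $X_k=\{x_0=\dots=x_{k-1}=0\}$; with $\zeta=c_1^T(\mathcal{O}(1))$ one has $\sigma_k=\prod_{m=1}^k(\zeta+t_m)$. Structure constants $C^k_{i,j}\in H_T^*(\mathrm{pt})$ are defined by $\sigma_i\sigma_j=\sum_kC^k_{i,j}\sigma_k$, and $\beta_m:=t_m-t_{m+1}$. -}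

module Defs where

open import Data.Nat as ℕ using (ℕ; zero; suc)
open import Data.Integer as ℤ using (ℤ; +_; -[1+_])
open import Data.Fin using (Fin; zero; suc; inject₁)
open import Data.List as List using (List; []; _∷_; foldr; map; take; tabulate)
open import Data.Vec as Vec using (Vec; []; _∷_)
open import Data.Product using (Σ; _×_; _,_; proj₁)
open import Relation.Binary.PropositionalEquality using (_≡_)

-- Univariate polynomials in ζ over ℤ, as coefficient lists
-- (constant term first).  Equality is coefficientwise (so trailing
-- zeros are irrelevant).

Poly : Set
Poly = List ℤ

infixl 6 _⊕_
infixl 7 _⊛_

_⊕_ : Poly → Poly → Poly
[]      ⊕ g       = g
(a ∷ f) ⊕ []      = a ∷ f
(a ∷ f) ⊕ (b ∷ g) = (a ℤ.+ b) ∷ (f ⊕ g)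

scale : ℤ → Poly → Poly
scale c f = map (c ℤ.*_) f

negP : Poly → Poly
negP = scale (ℤ.- (+ 1))

_⊛_ : Poly → Poly → Poly
[]      ⊛ g = []
(a ∷ f) ⊛ g = scale a g ⊕ (+ 0 ∷ (f ⊛ g))

coeff : Poly → ℕ → ℤ
coeff []      d       = + 0
coeff (a ∷ f) zero    = a
coeff (a ∷ f) (suc d) = coeff f d

_≈ₚ_ : Poly → Poly → Set
f ≈ₚ g = ∀ d → coeff f d ≡ coeff g d

_≡_[mod_] : Poly → Poly → Poly → Set
f ≡ g [mod p ] = Σ Poly λ q → (f ⊕ negP g) ≈ₚ (q ⊛ p)

sumP : ∀ {m} → (Fin m → Poly) → Poly
sumP F = foldr _⊕_ [] (tabulate F)

-- Equivariant cohomology of ℙⁿ, specialised at an integer point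
-- t = (t₁,…,t_{n+1}) (t₁ is  t zero):
--   H_T^*(ℙⁿ) = ℤ[t][ζ] / (∏_{m=1}^{n+1} (ζ + t_m)).

linProd : List ℤ → Poly
linProd = foldr (λ c acc → (c ∷ + 1 ∷ []) ⊛ acc) (+ 1 ∷ [])

σ : ∀ {n} → (Fin (suc n) → ℤ) → ℕ → Poly
σ t k = linProd (take k (tabulate t))

rel : ∀ {n} → (Fin (suc n) → ℤ) → Poly
rel t = linProd (tabulate t)

β : ∀ {n} → (Fin (suc n) → ℤ) → Fin n → ℤ
β t m = t (inject₁ m) ℤ.- t (suc m)

MPolyℕ : ℕ → Set
MPolyℕ n = List (ℕ × Vec ℕ n)

monomial : ∀ {n} → Vec ℕ n → (Fin n → ℤ) → ℤ
monomial []       x = + 1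
monomial (e ∷ es) x = (x zero ℤ.^ e) ℤ.* monomial es (λ i → x (suc i))

evalM : ∀ {n} → MPolyℕ n → (Fin n → ℤ) → ℤ
evalM P x = foldr ℤ._+_ (+ 0) (map (λ { (c , e) → (+ c) ℤ.* monomial e x }) P)

coeffSum : ∀ {n} → MPolyℕ n → ℕ
coeffSum P = foldr ℕ._+_ 0 (map proj₁ P)

{-# OPTIONS --safe #-}

-- Write ℤ[ζ] in the basis σ_k = ∏_{l<k} (ζ + T l), k ∈ ℕ, where T l = t_{l+1} (and T l = 0 for l > n).
-- Multiplication by ζ acts on coordinate sequences by ζ σ_k = σ_{k+1} − T k σ_k, and a polynomial f
-- acts by Horner evaluation at this operator; applied to σ_0 it yields the σ-coordinates of f.
-- Multiples of rel = σ_{n+1} have no coordinates below n+1, so C^k_{ij} is the k-th coordinate of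
-- σ_i σ_j. For i ≤ j, σ_i σ_j = (ζ + T (i−1)) ⋯ (ζ + T 0) σ_j, and ζ + T a sends coordinates w to
-- w_{k-1} + (T a − T k) w_k. All coordinates below j vanish and a < j, so only k > a occur, where
-- T a − T k = β_{a+1} + ⋯ + β_k has nonnegative coefficients. The number N(a, r) of terms of the
-- coefficient of σ_{a+j−r} in σ_a σ_j obeys N(a+1, r) = N(a, r) + (j − r + 1) N(a, r − 1), which
-- r! C(a,r) C(j,r) solves by Pascal's rule and (r+1) C(j, r+1) = (j − r) C(j, r).

module Submission where

open import Defs
open import Data.Nat using (ℕ; suc; _+_; _*_; _∸_; _≤_; _!)
open import Data.Nat.Combinatorics using (_C_)
open import Data.Integer using (ℤ; +_)
open import Data.Fin using (Fin; toℕ)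
open import Data.Product using (Σ; _×_)
open import Relation.Binary.PropositionalEquality using (_≡_)

open import Data.Nat using (zero; _<_; z≤n; s≤s)
open import Data.Nat.Combinatorics as Binomial using ()
open import Data.Nat.ListAction using (sum)
open import Data.Nat.Tactic.RingSolver using () renaming (solve-∀ to ℕ-solve-∀)
open import Data.Integer using (-_; -1ℤ) renaming (_+_ to _+ᶻ_; _*_ to _*ᶻ_; _-_ to _-ᶻ_; _^_ to _^ᶻ_)
open import Data.Integer.Tactic.RingSolver using (solve-∀)
open import Data.Fin using (zero; suc; inject₁)
open import Data.List using ([]; _∷_; _∷ʳ_; _++_; foldr; map; take; tabulate)
open import Data.Vec using (Vec; []; _∷_; replicate)
open import Data.Product using (_,_; proj₁)
open import Data.Sum using (inj₁; inj₂)
open import Function using (_∘_)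
open import Relation.Binary.PropositionalEquality
  using (_≢_; _≗_; refl; sym; trans; cong; cong₂; subst; module ≡-Reasoning)
open import Relation.Nullary using (yes; no; contradiction)
import Data.Nat.Properties as ℕ
import Data.Nat.ListAction.Properties as ListAction
import Data.Integer.Properties as ℤ
import Data.Fin.Properties as Fin
import Data.List.Properties as List

-- Horner evaluation at a linear operator on sequences

Seq : Set
Seq = ℕ → ℤ

infixl 6 _+ˢ_
infixr 7 _·ˢ_

_+ˢ_ : Seq → Seq → Seq
(v +ˢ w) k = v k +ᶻ w k

_·ˢ_ : ℤ → Seq → Seq
(a ·ˢ v) k = a *ᶻ v k

0ˢ : Seq
0ˢ _ = + 0

record IsLinear (M : Seq → Seq) : Set where
  field
    cong-≗ : ∀ {v w} → v ≗ w → M v ≗ M w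
    +-homo : ∀ v w → M (v +ˢ w) ≗ M v +ˢ M w
    ·-homo : ∀ a v → M (a ·ˢ v) ≗ a ·ˢ M v

  0-homo : M 0ˢ ≗ 0ˢ
  0-homo k = trans (cong-≗ {0ˢ} {+ 0 ·ˢ 0ˢ} (λ _ → refl) k) (·-homo (+ 0) 0ˢ k)

ζ+_ : ℤ → Poly
ζ+ c = c ∷ + 1 ∷ []

module Horner {M : Seq → Seq} (M-linear : IsLinear M) where
  open IsLinear M-linear renaming (cong-≗ to M-cong; +-homo to M-+; ·-homo to M-·; 0-homo to M-0)

  act : Poly → Seq → Seq
  act []      v = 0ˢ
  act (a ∷ f) v = a ·ˢ v +ˢ M (act f v)

  act-cong : ∀ f {v w} → v ≗ w → act f v ≗ act f w
  act-cong []      v≗w k = refl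
  act-cong (a ∷ f) v≗w k = cong₂ (λ x y → a *ᶻ x +ᶻ y) (v≗w k) (M-cong (act-cong f v≗w) k)

  act-0ˢ : ∀ f → act f 0ˢ ≗ 0ˢ
  act-0ˢ []      k = refl
  act-0ˢ (a ∷ f) k = begin
    a *ᶻ + 0 +ᶻ M (act f 0ˢ) k ≡⟨ cong₂ _+ᶻ_ (ℤ.*-zeroʳ a) (trans (M-cong (act-0ˢ f) k) (M-0 k)) ⟩
    + 0                        ∎
    where open ≡-Reasoning

  act-+ˢ : ∀ f v w → act f (v +ˢ w) ≗ act f v +ˢ act f w
  act-+ˢ []      v w k = refl
  act-+ˢ (a ∷ f) v w k = begin
    a *ᶻ (v k +ᶻ w k) +ᶻ M (act f (v +ˢ w)) k
      ≡⟨ cong (a *ᶻ (v k +ᶻ w k) +ᶻ_) (trans (M-cong (act-+ˢ f v w) k) (M-+ _ _ k)) ⟩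
    a *ᶻ (v k +ᶻ w k) +ᶻ (M (act f v) k +ᶻ M (act f w) k)
      ≡⟨ regroup a (v k) (w k) _ _ ⟩
    (a *ᶻ v k +ᶻ M (act f v) k) +ᶻ (a *ᶻ w k +ᶻ M (act f w) k) ∎
    where
    open ≡-Reasoning
    regroup : ∀ a x y p q → a *ᶻ (x +ᶻ y) +ᶻ (p +ᶻ q) ≡ (a *ᶻ x +ᶻ p) +ᶻ (a *ᶻ y +ᶻ q)
    regroup = solve-∀

  act-·ˢ : ∀ f c v → act f (c ·ˢ v) ≗ c ·ˢ act f v
  act-·ˢ []      c v k = sym (ℤ.*-zeroʳ c)
  act-·ˢ (a ∷ f) c v k = begin
    a *ᶻ (c *ᶻ v k) +ᶻ M (act f (c ·ˢ v)) k
      ≡⟨ cong (a *ᶻ (c *ᶻ v k) +ᶻ_) (trans (M-cong (act-·ˢ f c v) k) (M-· c _ k)) ⟩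
    a *ᶻ (c *ᶻ v k) +ᶻ c *ᶻ M (act f v) k
      ≡⟨ regroup a c (v k) _ ⟩
    c *ᶻ (a *ᶻ v k +ᶻ M (act f v) k) ∎
    where
    open ≡-Reasoning
    regroup : ∀ a c x p → a *ᶻ (c *ᶻ x) +ᶻ c *ᶻ p ≡ c *ᶻ (a *ᶻ x +ᶻ p)
    regroup = solve-∀

  act-M : ∀ f v → act f (M v) ≗ M (act f v)
  act-M []      v k = sym (M-0 k)
  act-M (a ∷ f) v k = begin
    a *ᶻ M v k +ᶻ M (act f (M v)) k    ≡⟨ cong₂ _+ᶻ_ (sym (M-· a v k)) (M-cong (act-M f v) k) ⟩
    M (a ·ˢ v) k +ᶻ M (M (act f v)) k  ≡⟨ M-+ _ _ k ⟨
    M (a ·ˢ v +ˢ M (act f v)) k        ∎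
    where open ≡-Reasoning

  act-comm : ∀ f g v → act f (act g v) ≗ act g (act f v)
  act-comm f []      v k = act-0ˢ f k
  act-comm f (b ∷ g) v k = begin
    act f (b ·ˢ v +ˢ M (act g v)) k             ≡⟨ act-+ˢ f _ _ k ⟩
    act f (b ·ˢ v) k +ᶻ act f (M (act g v)) k   ≡⟨ cong₂ _+ᶻ_ (act-·ˢ f b v k) (act-M f _ k) ⟩
    b *ᶻ act f v k +ᶻ M (act f (act g v)) k     ≡⟨ cong (b *ᶻ act f v k +ᶻ_) (M-cong (act-comm f g v) k) ⟩
    b *ᶻ act f v k +ᶻ M (act g (act f v)) k     ∎
    where open ≡-Reasoning

  act-⊕ : ∀ f g v → act (f ⊕ g) v ≗ act f v +ˢ act g v
  act-⊕ []      g       v k = sym (ℤ.+-identityˡ _)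
  act-⊕ (a ∷ f) []      v k = sym (ℤ.+-identityʳ _)
  act-⊕ (a ∷ f) (b ∷ g) v k = begin
    (a +ᶻ b) *ᶻ v k +ᶻ M (act (f ⊕ g) v) k
      ≡⟨ cong ((a +ᶻ b) *ᶻ v k +ᶻ_) (trans (M-cong (act-⊕ f g v) k) (M-+ _ _ k)) ⟩
    (a +ᶻ b) *ᶻ v k +ᶻ (M (act f v) k +ᶻ M (act g v) k)
      ≡⟨ regroup a b (v k) _ _ ⟩
    (a *ᶻ v k +ᶻ M (act f v) k) +ᶻ (b *ᶻ v k +ᶻ M (act g v) k) ∎
    where
    open ≡-Reasoning
    regroup : ∀ a b x p q → (a +ᶻ b) *ᶻ x +ᶻ (p +ᶻ q) ≡ (a *ᶻ x +ᶻ p) +ᶻ (b *ᶻ x +ᶻ q)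
    regroup = solve-∀

  act-scale : ∀ c f v → act (scale c f) v ≗ c ·ˢ act f v
  act-scale c []      v k = sym (ℤ.*-zeroʳ c)
  act-scale c (a ∷ f) v k = begin
    c *ᶻ a *ᶻ v k +ᶻ M (act (scale c f) v) k
      ≡⟨ cong (c *ᶻ a *ᶻ v k +ᶻ_) (trans (M-cong (act-scale c f v) k) (M-· c _ k)) ⟩
    c *ᶻ a *ᶻ v k +ᶻ c *ᶻ M (act f v) k
      ≡⟨ regroup c a (v k) _ ⟩
    c *ᶻ (a *ᶻ v k +ᶻ M (act f v) k) ∎
    where
    open ≡-Reasoning
    regroup : ∀ c a x p → c *ᶻ a *ᶻ x +ᶻ c *ᶻ p ≡ c *ᶻ (a *ᶻ x +ᶻ p)
    regroup = solve-∀

  act-⊛ : ∀ f g v → act (f ⊛ g) v ≗ act f (act g v)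
  act-⊛ []      g v k = refl
  act-⊛ (a ∷ f) g v k = begin
    act (scale a g ⊕ (+ 0 ∷ f ⊛ g)) v k
      ≡⟨ act-⊕ (scale a g) _ v k ⟩
    act (scale a g) v k +ᶻ (+ 0 *ᶻ v k +ᶻ M (act (f ⊛ g) v) k)
      ≡⟨ cong₂ (λ x y → x +ᶻ (+ 0 +ᶻ y)) (act-scale a g v k) (M-cong (act-⊛ f g v) k) ⟩
    a *ᶻ act g v k +ᶻ (+ 0 +ᶻ M (act f (act g v)) k)
      ≡⟨ cong (a *ᶻ act g v k +ᶻ_) (ℤ.+-identityˡ _) ⟩
    a *ᶻ act g v k +ᶻ M (act f (act g v)) k ∎
    where open ≡-Reasoning

  act-⊛-comm : ∀ f g v → act (f ⊛ g) v ≗ act (g ⊛ f) v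
  act-⊛-comm f g v k =
    trans (act-⊛ f g v k) (trans (act-comm f g v k) (sym (act-⊛ g f v k)))

  act-zeroCoeffs : ∀ f v → (∀ d → coeff f d ≡ + 0) → act f v ≗ 0ˢ
  act-zeroCoeffs []      v f≈0 k = refl
  act-zeroCoeffs (a ∷ f) v f≈0 k = begin
    a *ᶻ v k +ᶻ M (act f v) k  ≡⟨ cong₂ _+ᶻ_ (cong (_*ᶻ v k) (f≈0 0)) tail≡0 ⟩
    + 0 *ᶻ v k +ᶻ + 0          ∎
    where
    open ≡-Reasoning
    tail≡0 : M (act f v) k ≡ + 0
    tail≡0 = trans (M-cong (act-zeroCoeffs f v (λ d → f≈0 (suc d))) k) (M-0 k)

  act-≈ₚ : ∀ f g v → f ≈ₚ g → act f v ≗ act g v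
  act-≈ₚ []      []      v f≈g k = refl
  act-≈ₚ []      (b ∷ g) v f≈g k = sym (act-zeroCoeffs (b ∷ g) v (λ d → sym (f≈g d)) k)
  act-≈ₚ (a ∷ f) []      v f≈g k = act-zeroCoeffs (a ∷ f) v f≈g k
  act-≈ₚ (a ∷ f) (b ∷ g) v f≈g k =
    cong₂ (λ c y → c *ᶻ v k +ᶻ y) (f≈g 0) (M-cong (act-≈ₚ f g v (λ d → f≈g (suc d))) k)

  act-1 : ∀ v → act (+ 1 ∷ []) v ≗ v
  act-1 v k = trans (cong₂ _+ᶻ_ (ℤ.*-identityˡ (v k)) (M-0 k)) (ℤ.+-identityʳ (v k))

  act-ζ+ : ∀ c v → act (ζ+ c) v ≗ c ·ˢ v +ˢ M v
  act-ζ+ c v k = cong (c *ᶻ v k +ᶻ_) (M-cong (act-1 v) k)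

  act-linProd-∷ʳ : ∀ cs c v → act (linProd (cs ∷ʳ c)) v ≗ act (ζ+ c) (act (linProd cs) v)
  act-linProd-∷ʳ []       c v = act-⊛ (ζ+ c) (+ 1 ∷ []) v
  act-linProd-∷ʳ (d ∷ cs) c v k = begin
    act (ζ+ d ⊛ linProd (cs ∷ʳ c)) v k                ≡⟨ act-⊛ (ζ+ d) (linProd (cs ∷ʳ c)) v k ⟩
    act (ζ+ d) (act (linProd (cs ∷ʳ c)) v) k          ≡⟨ act-cong (ζ+ d) (act-linProd-∷ʳ cs c v) k ⟩
    act (ζ+ d) (act (ζ+ c) (act (linProd cs) v)) k    ≡⟨ act-comm (ζ+ d) (ζ+ c) (act (linProd cs) v) k ⟩
    act (ζ+ c) (act (ζ+ d) (act (linProd cs) v)) k    ≡⟨ act-cong (ζ+ c) (act-⊛ (ζ+ d) (linProd cs) v) k ⟨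
    act (ζ+ c) (act (ζ+ d ⊛ linProd cs) v) k          ∎
    where open ≡-Reasoning

  act-sumP : ∀ {m} (F : Fin m → Poly) v k → act (sumP F) v k ≡ foldr _+ᶻ_ (+ 0) (tabulate (λ l → act (F l) v k))
  act-sumP {zero}  F v k = refl
  act-sumP {suc m} F v k =
    trans (act-⊕ (F zero) (sumP (λ l → F (suc l))) v k) (cong (act (F zero) v k +ᶻ_) (act-sumP (λ l → F (suc l)) v k))

-- Coordinates in the basis σ_k

δ : ℕ → Seq
δ zero    zero    = + 1
δ zero    (suc k) = + 0
δ (suc a) zero    = + 0
δ (suc a) (suc k) = δ a k

δ-annihilates-diff : ∀ (f : Seq) a k → (f a -ᶻ f k) *ᶻ δ a k ≡ + 0
δ-annihilates-diff f zero    zero    = trans (ℤ.*-identityʳ _) (ℤ.+-inverseʳ (f zero))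
δ-annihilates-diff f zero    (suc k) = ℤ.*-zeroʳ (f zero -ᶻ f (suc k))
δ-annihilates-diff f (suc a) zero    = ℤ.*-zeroʳ (f (suc a) -ᶻ f zero)
δ-annihilates-diff f (suc a) (suc k) = δ-annihilates-diff (λ m → f (suc m)) a k

_VanishesBelow_ : Seq → ℕ → Set
v VanishesBelow m = ∀ {k} → k < m → v k ≡ + 0

δ-vanishesBelow : ∀ a → δ a VanishesBelow a
δ-vanishesBelow (suc a) {zero}  _         = refl
δ-vanishesBelow (suc a) {suc k} (s≤s k<a) = δ-vanishesBelow a k<a

module ζ-Action (T : Seq) where

  -- ζ σ_k = σ_{k+1} − T k σ_k
  ζ· : Seq → Seq
  ζ· v zero    = - (T zero *ᶻ v zero)
  ζ· v (suc k) = v k -ᶻ T (suc k) *ᶻ v (suc k)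

  ζ·-linear : IsLinear ζ·
  ζ·-linear = record { cong-≗ = cong-≗ ; +-homo = +-homo ; ·-homo = ·-homo }
    where
    cong-≗ : ∀ {v w} → v ≗ w → ζ· v ≗ ζ· w
    cong-≗ v≗w zero    = cong (λ x → - (T zero *ᶻ x)) (v≗w zero)
    cong-≗ v≗w (suc k) = cong₂ (λ x y → x -ᶻ T (suc k) *ᶻ y) (v≗w k) (v≗w (suc k))

    +-homo : ∀ v w → ζ· (v +ˢ w) ≗ ζ· v +ˢ ζ· w
    +-homo v w zero    = ring (T zero) (v zero) (w zero)
      where
      ring : ∀ t x y → - (t *ᶻ (x +ᶻ y)) ≡ - (t *ᶻ x) +ᶻ - (t *ᶻ y)
      ring = solve-∀
    +-homo v w (suc k) = ring (T (suc k)) (v k) (w k) (v (suc k)) (w (suc k))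
      where
      ring : ∀ t x y x′ y′ → (x +ᶻ y) -ᶻ t *ᶻ (x′ +ᶻ y′) ≡ (x -ᶻ t *ᶻ x′) +ᶻ (y -ᶻ t *ᶻ y′)
      ring = solve-∀

    ·-homo : ∀ a v → ζ· (a ·ˢ v) ≗ a ·ˢ ζ· v
    ·-homo a v zero    = ring a (T zero) (v zero)
      where
      ring : ∀ a t x → - (t *ᶻ (a *ᶻ x)) ≡ a *ᶻ - (t *ᶻ x)
      ring = solve-∀
    ·-homo a v (suc k) = ring a (T (suc k)) (v k) (v (suc k))
      where
      ring : ∀ a t x x′ → a *ᶻ x -ᶻ t *ᶻ (a *ᶻ x′) ≡ a *ᶻ (x -ᶻ t *ᶻ x′)
      ring = solve-∀

  open Horner ζ·-linear public

  act-ζ+-zero : ∀ c v → act (ζ+ c) v zero ≡ (c -ᶻ T zero) *ᶻ v zero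
  act-ζ+-zero c v = trans (act-ζ+ c v zero) (ring c (T zero) (v zero))
    where
    ring : ∀ c t x → c *ᶻ x +ᶻ - (t *ᶻ x) ≡ (c -ᶻ t) *ᶻ x
    ring = solve-∀

  act-ζ+-suc : ∀ c v k → act (ζ+ c) v (suc k) ≡ v k +ᶻ (c -ᶻ T (suc k)) *ᶻ v (suc k)
  act-ζ+-suc c v k = trans (act-ζ+ c v (suc k)) (ring c (T (suc k)) (v k) (v (suc k)))
    where
    ring : ∀ c t x x′ → c *ᶻ x′ +ᶻ (x -ᶻ t *ᶻ x′) ≡ x +ᶻ (c -ᶻ t) *ᶻ x′
    ring = solve-∀

  act-ζ+-δ : ∀ a → act (ζ+ T a) (δ a) ≗ δ (suc a)
  act-ζ+-δ a zero    = trans (act-ζ+-zero (T a) (δ a)) (δ-annihilates-diff T a zero)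
  act-ζ+-δ a (suc k) = begin
    act (ζ+ T a) (δ a) (suc k)                         ≡⟨ act-ζ+-suc (T a) (δ a) k ⟩
    δ a k +ᶻ (T a -ᶻ T (suc k)) *ᶻ δ a (suc k)         ≡⟨ cong (δ a k +ᶻ_) (δ-annihilates-diff T a (suc k)) ⟩
    δ a k +ᶻ + 0                                       ≡⟨ ℤ.+-identityʳ (δ a k) ⟩
    δ a k                                              ∎
    where open ≡-Reasoning

  ζ·-vanishesBelow : ∀ {m v} → v VanishesBelow m → ζ· v VanishesBelow m
  ζ·-vanishesBelow v≈0 {zero}  0<m   =
    trans (cong (λ x → - (T zero *ᶻ x)) (v≈0 0<m)) (cong -_ (ℤ.*-zeroʳ (T zero)))
  ζ·-vanishesBelow v≈0 {suc k} k+1<m =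
    trans (cong₂ (λ x y → x -ᶻ T (suc k) *ᶻ y) (v≈0 (ℕ.<-trans (ℕ.n<1+n k) k+1<m)) (v≈0 k+1<m))
          (cong (λ x → + 0 -ᶻ x) (ℤ.*-zeroʳ (T (suc k))))

  act-vanishesBelow : ∀ f {m v} → v VanishesBelow m → act f v VanishesBelow m
  act-vanishesBelow []      v≈0 k<m = refl
  act-vanishesBelow (a ∷ f) v≈0 k<m =
    trans (cong₂ (λ x y → a *ᶻ x +ᶻ y) (v≈0 k<m) (ζ·-vanishesBelow (act-vanishesBelow f v≈0) k<m))
          (cong (_+ᶻ + 0) (ℤ.*-zeroʳ a))

  σ-act : ℕ → Seq → Seq
  σ-act zero    v = v
  σ-act (suc a) v = act (ζ+ T a) (σ-act a v)

  σ-act-δ₀ : ∀ a → σ-act a (δ 0) ≗ δ a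
  σ-act-δ₀ zero    k = refl
  σ-act-δ₀ (suc a) k = trans (act-cong (ζ+ T a) (σ-act-δ₀ a) k) (act-ζ+-δ a k)

  σ-act-vanishesBelow : ∀ a {m v} → v VanishesBelow m → σ-act a v VanishesBelow m
  σ-act-vanishesBelow zero    v≈0 = v≈0
  σ-act-vanishesBelow (suc a) v≈0 = act-vanishesBelow (ζ+ T a) (σ-act-vanishesBelow a v≈0)

sum-δ : ∀ {m} (d : Fin m → ℤ) k → foldr _+ᶻ_ (+ 0) (tabulate (λ l → d l *ᶻ δ (toℕ l) (toℕ k))) ≡ d k
sum-δ d zero    = begin
  d zero *ᶻ + 1 +ᶻ foldr _+ᶻ_ (+ 0) (tabulate (λ l → d (suc l) *ᶻ + 0))
    ≡⟨ cong₂ _+ᶻ_ (ℤ.*-identityʳ (d zero)) (all-zero (λ l → d (suc l))) ⟩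
  d zero +ᶻ + 0
    ≡⟨ ℤ.+-identityʳ (d zero) ⟩
  d zero ∎
  where
  open ≡-Reasoning
  all-zero : ∀ {m} (e : Fin m → ℤ) → foldr _+ᶻ_ (+ 0) (tabulate (λ l → e l *ᶻ + 0)) ≡ + 0
  all-zero {zero}  e = refl
  all-zero {suc m} e = cong₂ _+ᶻ_ (ℤ.*-zeroʳ (e zero)) (all-zero (λ l → e (suc l)))
sum-δ d (suc k) = trans (cong (_+ᶻ rest) (ℤ.*-zeroʳ (d zero))) (trans (ℤ.+-identityˡ rest) (sum-δ (λ l → d (suc l)) k))
  where rest = foldr _+ᶻ_ (+ 0) (tabulate (λ l → d (suc l) *ᶻ δ (toℕ l) (toℕ k)))

toSeq : ∀ {m} → (Fin m → ℤ) → Seq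
toSeq {zero}  f k       = + 0
toSeq {suc m} f zero    = f zero
toSeq {suc m} f (suc k) = toSeq (λ i → f (suc i)) k

toSeq-toℕ : ∀ {m} (f : Fin m → ℤ) i → toSeq f (toℕ i) ≡ f i
toSeq-toℕ f zero    = refl
toSeq-toℕ f (suc i) = toSeq-toℕ (λ l → f (suc l)) i

take-suc-tabulate-toSeq : ∀ {m} (f : Fin m → ℤ) {a} → a < m → take (suc a) (tabulate f) ≡ take a (tabulate f) ∷ʳ toSeq f a
take-suc-tabulate-toSeq {suc m} f {zero}  _         = refl
take-suc-tabulate-toSeq {suc m} f {suc a} (s≤s a<m) = cong (f zero ∷_) (take-suc-tabulate-toSeq (λ i → f (suc i)) a<m)

module σ-Coordinates {n} (t : Fin (suc n) → ℤ) where

  T : Seq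
  T = toSeq t

  open ζ-Action T public

  act-σ : ∀ {a} → a ≤ suc n → ∀ v → act (σ t a) v ≗ σ-act a v
  act-σ {zero}  _   v = act-1 v
  act-σ {suc a} a<n+1 v k = begin
    act (linProd (take (suc a) (tabulate t))) v k
      ≡⟨ cong (λ cs → act (linProd cs) v k) (take-suc-tabulate-toSeq t a<n+1) ⟩
    act (linProd (take a (tabulate t) ∷ʳ T a)) v k
      ≡⟨ act-linProd-∷ʳ (take a (tabulate t)) (T a) v k ⟩
    act (ζ+ T a) (act (σ t a) v) k
      ≡⟨ act-cong (ζ+ T a) (act-σ (ℕ.<⇒≤ a<n+1) v) k ⟩
    σ-act (suc a) v k ∎
    where open ≡-Reasoning

  act-σ-δ₀ : ∀ {a} → a ≤ suc n → act (σ t a) (δ 0) ≗ δ a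
  act-σ-δ₀ {a} a≤n+1 k = trans (act-σ a≤n+1 (δ 0) k) (σ-act-δ₀ a k)

  rel≡σ : rel t ≡ σ t (suc n)
  rel≡σ = cong linProd (sym (List.take-all (suc n) (tabulate t) (ℕ.≤-reflexive (List.length-tabulate t))))

  act-⊛-rel-vanishesBelow : ∀ q → act (q ⊛ rel t) (δ 0) VanishesBelow suc n
  act-⊛-rel-vanishesBelow q {k} k<m = trans (act-⊛ q (rel t) (δ 0) k) (act-vanishesBelow q rel-vanishes k<m)
    where
    rel-vanishes : act (rel t) (δ 0) VanishesBelow suc n
    rel-vanishes {l} l<m =
      trans (cong (λ p → act p (δ 0) l) rel≡σ) (trans (act-σ-δ₀ ℕ.≤-refl l) (δ-vanishesBelow (suc n) l<m))

  σ-coordinate : ∀ f (c : Fin (suc n) → ℤ) → f ≡ sumP (λ l → scale (c l) (σ t (toℕ l))) [mod rel t ] →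
                 ∀ k → c k ≡ act f (δ 0) (toℕ k)
  σ-coordinate f c (q , f-S≈q*rel) k = sym (ℤ.i-j≡0⇒i≡j (act f (δ 0) K) (c k) f-S≡0)
    where
    open ≡-Reasoning
    K = toℕ k
    S = sumP (λ l → scale (c l) (σ t (toℕ l)))

    act-S : act S (δ 0) K ≡ c k
    act-S = begin
      act S (δ 0) K
        ≡⟨ act-sumP (λ l → scale (c l) (σ t (toℕ l))) (δ 0) K ⟩
      foldr _+ᶻ_ (+ 0) (tabulate (λ l → act (scale (c l) (σ t (toℕ l))) (δ 0) K))
        ≡⟨ cong (foldr _+ᶻ_ (+ 0)) (List.tabulate-cong λ l →
             trans (act-scale (c l) (σ t (toℕ l)) (δ 0) K) (cong (c l *ᶻ_) (act-σ-δ₀ (Fin.toℕ≤n l) K))) ⟩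
      foldr _+ᶻ_ (+ 0) (tabulate (λ l → c l *ᶻ δ (toℕ l) K))
        ≡⟨ sum-δ c k ⟩
      c k ∎

    f-S≡0 : act f (δ 0) K -ᶻ c k ≡ + 0
    f-S≡0 = begin
      act f (δ 0) K -ᶻ c k                     ≡⟨ cong (act f (δ 0) K +ᶻ_) (ℤ.-1*i≡-i (c k)) ⟨
      act f (δ 0) K +ᶻ -1ℤ *ᶻ c k              ≡⟨ cong (λ x → act f (δ 0) K +ᶻ -1ℤ *ᶻ x) act-S ⟨
      act f (δ 0) K +ᶻ -1ℤ *ᶻ act S (δ 0) K    ≡⟨ cong (act f (δ 0) K +ᶻ_) (act-scale -1ℤ S (δ 0) K) ⟨
      act f (δ 0) K +ᶻ act (negP S) (δ 0) K    ≡⟨ act-⊕ f (negP S) (δ 0) K ⟨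
      act (f ⊕ negP S) (δ 0) K                 ≡⟨ act-≈ₚ (f ⊕ negP S) (q ⊛ rel t) (δ 0) f-S≈q*rel K ⟩
      act (q ⊛ rel t) (δ 0) K                  ≡⟨ act-⊛-rel-vanishesBelow q (s≤s (Fin.toℕ≤pred[n] k)) ⟩
      + 0                                      ∎

  β≡T-diff : ∀ i → β t i ≡ T (toℕ i) -ᶻ T (suc (toℕ i))
  β≡T-diff i = sym (cong₂ _-ᶻ_ (trans (cong T (sym (Fin.toℕ-inject₁ i))) (toSeq-toℕ t (inject₁ i)))
                                   (toSeq-toℕ t (suc i)))

-- Polynomials in the β's with natural coefficients

-- a no-op when p ≥ m
incAt : ∀ {m} → ℕ → Vec ℕ m → Vec ℕ m
incAt p       []       = []
incAt zero    (e ∷ es) = suc e ∷ es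
incAt (suc p) (e ∷ es) = e ∷ incAt p es

one : ∀ {m} → MPolyℕ m
one {m} = (1 , replicate m 0) ∷ []

mulVar : ∀ {m} → ℕ → MPolyℕ m → MPolyℕ m
mulVar p = map (λ (c , e) → c , incAt p e)

mulRange : ∀ {m} → ℕ → ℕ → MPolyℕ m → MPolyℕ m
mulRange p zero    Q = []
mulRange p (suc c) Q = mulVar p Q ++ mulRange (suc p) c Q

coeffSum-++ : ∀ {m} (P Q : MPolyℕ m) → coeffSum (P ++ Q) ≡ coeffSum P + coeffSum Q
coeffSum-++ P Q = trans (cong sum (List.map-++ proj₁ P Q)) (ListAction.sum-++ (map proj₁ P) (map proj₁ Q))

coeffSum-mulVar : ∀ {m} p (Q : MPolyℕ m) → coeffSum (mulVar p Q) ≡ coeffSum Q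
coeffSum-mulVar p []            = refl
coeffSum-mulVar p ((c , e) ∷ Q) = cong (λ s → c + s) (coeffSum-mulVar p Q)

coeffSum-mulRange : ∀ {m} p c (Q : MPolyℕ m) → coeffSum (mulRange p c Q) ≡ c * coeffSum Q
coeffSum-mulRange p zero    Q = refl
coeffSum-mulRange p (suc c) Q =
  trans (coeffSum-++ (mulVar p Q) (mulRange (suc p) c Q)) (cong₂ _+_ (coeffSum-mulVar p Q) (coeffSum-mulRange (suc p) c Q))

module _ {m} (x : Fin m → ℤ) where

  evalM-++ : ∀ P Q → evalM (P ++ Q) x ≡ evalM P x +ᶻ evalM Q x
  evalM-++ []            Q = sym (ℤ.+-identityˡ (evalM Q x))
  evalM-++ ((c , e) ∷ P) Q =
    trans (cong (+ c *ᶻ monomial e x +ᶻ_) (evalM-++ P Q)) (sym (ℤ.+-assoc (+ c *ᶻ monomial e x) (evalM P x) (evalM Q x)))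

  evalM-one : evalM one x ≡ + 1
  evalM-one = cong (λ y → + 1 *ᶻ y +ᶻ + 0) (monomial-zeros x)
    where
    monomial-zeros : ∀ {m} (x : Fin m → ℤ) → monomial (replicate m 0) x ≡ + 1
    monomial-zeros {zero}  x = refl
    monomial-zeros {suc m} x = trans (ℤ.*-identityˡ _) (monomial-zeros (λ i → x (suc i)))

monomial-incAt : ∀ {m} (x : Fin m → ℤ) (X : Seq) → (∀ i → x i ≡ X (toℕ i)) →
                 ∀ {p} → p < m → ∀ e → monomial (incAt p e) x ≡ X p *ᶻ monomial e x
monomial-incAt x X x≡X {zero}  _         (e ∷ es) =
  trans (ℤ.*-assoc (x zero) (x zero ^ᶻ e) _) (cong (λ y → y *ᶻ (x zero ^ᶻ e *ᶻ _)) (x≡X zero))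
monomial-incAt x X x≡X {suc p} (s≤s p<m) (e ∷ es) =
  trans (cong (x zero ^ᶻ e *ᶻ_) (monomial-incAt (λ i → x (suc i)) (λ l → X (suc l)) (λ i → x≡X (suc i)) p<m es))
        (ring (x zero ^ᶻ e) (X (suc p)) _)
  where
  ring : ∀ a b c → a *ᶻ (b *ᶻ c) ≡ b *ᶻ (a *ᶻ c)
  ring = solve-∀

module _ {m} (x : Fin m → ℤ) (X : Seq) (x≡X : ∀ i → x i ≡ X (toℕ i)) where

  evalM-mulVar : ∀ {p} → p < m → ∀ Q → evalM (mulVar p Q) x ≡ X p *ᶻ evalM Q x
  evalM-mulVar p<m []            = sym (ℤ.*-zeroʳ (X _))
  evalM-mulVar {p} p<m ((c , e) ∷ Q) = begin
    + c *ᶻ monomial (incAt p e) x +ᶻ evalM (mulVar p Q) x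
      ≡⟨ cong₂ (λ y z → + c *ᶻ y +ᶻ z) (monomial-incAt x X x≡X p<m e) (evalM-mulVar p<m Q) ⟩
    + c *ᶻ (X p *ᶻ monomial e x) +ᶻ X p *ᶻ evalM Q x
      ≡⟨ ring (+ c) (X p) (monomial e x) (evalM Q x) ⟩
    X p *ᶻ (+ c *ᶻ monomial e x +ᶻ evalM Q x) ∎
    where
    open ≡-Reasoning
    ring : ∀ c y μ q → c *ᶻ (y *ᶻ μ) +ᶻ y *ᶻ q ≡ y *ᶻ (c *ᶻ μ +ᶻ q)
    ring = solve-∀

-- Binomial identities

n*nCk≡k*nCk+[1+k]*nC[1+k] : ∀ n k → n * (n C k) ≡ k * (n C k) + suc k * (n C suc k)
n*nCk≡k*nCk+[1+k]*nC[1+k] zero    zero    = refl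
n*nCk≡k*nCk+[1+k]*nC[1+k] zero    (suc k) = sym (cong₂ _+_ (ℕ.*-zeroʳ (suc k)) (ℕ.*-zeroʳ (suc (suc k))))
n*nCk≡k*nCk+[1+k]*nC[1+k] (suc n) zero    =
  trans (ℕ.*-identityʳ (suc n)) (sym (trans (ℕ.*-identityˡ (suc n C 1)) (Binomial.nC1≡n (suc n))))
n*nCk≡k*nCk+[1+k]*nC[1+k] (suc n) (suc k) = begin
  suc n * (suc n C suc k)
    ≡⟨ cong (suc n *_) (Binomial.nCk+nC[k+1]≡[n+1]C[k+1] n k) ⟨
  suc n * (n C k + n C suc k)
    ≡⟨ expand n (n C k) (n C suc k) ⟩
  n * (n C k) + n * (n C suc k) + (n C k + n C suc k)
    ≡⟨ cong₂ (λ x y → x + y + (n C k + n C suc k))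
             (n*nCk≡k*nCk+[1+k]*nC[1+k] n k) (n*nCk≡k*nCk+[1+k]*nC[1+k] n (suc k)) ⟩
  k * (n C k) + suc k * (n C suc k) + (suc k * (n C suc k) + suc (suc k) * (n C suc (suc k)))
    + (n C k + n C suc k)
    ≡⟨ collect k (n C k) (n C suc k) (n C suc (suc k)) ⟩
  suc k * (n C k + n C suc k) + suc (suc k) * (n C suc k + n C suc (suc k))
    ≡⟨ cong₂ (λ x y → suc k * x + suc (suc k) * y)
             (Binomial.nCk+nC[k+1]≡[n+1]C[k+1] n k) (Binomial.nCk+nC[k+1]≡[n+1]C[k+1] n (suc k)) ⟩
  suc k * (suc n C suc k) + suc (suc k) * (suc n C suc (suc k)) ∎
  where
  open ≡-Reasoning
  expand : ∀ n x y → suc n * (x + y) ≡ n * x + n * y + (x + y)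
  expand = ℕ-solve-∀
  collect : ∀ k x y z → k * x + suc k * y + (suc k * y + suc (suc k) * z) + (x + y)
                        ≡ suc k * (x + y) + suc (suc k) * (y + z)
  collect = ℕ-solve-∀

[1+k]*nC[1+k]≡[n∸k]*nCk : ∀ n k → suc k * (n C suc k) ≡ (n ∸ k) * (n C k)
[1+k]*nC[1+k]≡[n∸k]*nCk n k = begin
  suc k * (n C suc k)                                  ≡⟨ ℕ.m+n∸m≡n (k * (n C k)) _ ⟨
  k * (n C k) + suc k * (n C suc k) ∸ k * (n C k)      ≡⟨ cong (_∸ k * (n C k)) (n*nCk≡k*nCk+[1+k]*nC[1+k] n k) ⟨
  n * (n C k) ∸ k * (n C k)                            ≡⟨ ℕ.*-distribʳ-∸ (n C k) n k ⟨
  (n ∸ k) * (n C k)                                    ∎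
  where open ≡-Reasoning

m+n≡o+p⇒m∸o≡p∸n : ∀ {m n o p} → m + n ≡ o + p → m ∸ o ≡ p ∸ n
m+n≡o+p⇒m∸o≡p∸n {m} {n} {o} {p} eq = begin
  m ∸ o              ≡⟨ ℕ.[m+n]∸[m+o]≡n∸o n m o ⟨
  (n + m) ∸ (n + o)  ≡⟨ cong₂ _∸_ (trans (ℕ.+-comm n m) eq) (ℕ.+-comm n o) ⟩
  (o + p) ∸ (o + n)  ≡⟨ ℕ.[m+n]∸[m+o]≡n∸o o p n ⟩
  p ∸ n              ∎
  where open ≡-Reasoning

-- The expansion of σ_a σ_j

module Expansion (n j : ℕ) where

  δᴾ : ℕ → ℕ → MPolyℕ n
  δᴾ zero    zero    = one
  δᴾ zero    (suc k) = []
  δᴾ (suc a) zero    = []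
  δᴾ (suc a) (suc k) = δᴾ a k

  -- The coefficient of σ_k in σ_a σ_j as a polynomial in x_l = β_{l+1} = T l − T (l+1):
  -- multiplying by ζ + T a sends coordinates w to w_k + (T a − T (k+1)) w_{k+1} (act-ζ+-suc),
  -- and T a − T (k+1) = x_a + ⋯ + x_k when a ≤ k+1 (otherwise w_{k+1} = 0).
  coeffPoly : ℕ → ℕ → MPolyℕ n
  coeffPoly zero    k       = δᴾ j k
  coeffPoly (suc a) zero    = []
  coeffPoly (suc a) (suc k) = coeffPoly a k ++ mulRange a (suc k ∸ a) (coeffPoly a (suc k))

  evalM-δᴾ : ∀ (x : Fin n → ℤ) a k → evalM (δᴾ a k) x ≡ δ a k
  evalM-δᴾ x zero    zero    = evalM-one x
  evalM-δᴾ x zero    (suc k) = refl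
  evalM-δᴾ x (suc a) zero    = refl
  evalM-δᴾ x (suc a) (suc k) = evalM-δᴾ x a k

  module _ (t : Fin (suc n) → ℤ) where
    open σ-Coordinates t

    evalM-mulRange : ∀ p c Q → p + c ≤ n → evalM (mulRange p c Q) (β t) ≡ (T p -ᶻ T (p + c)) *ᶻ evalM Q (β t)
    evalM-mulRange p zero    Q _ = sym (trans (cong (λ l → (T p -ᶻ T l) *ᶻ evalM Q (β t)) (ℕ.+-identityʳ p))
                                              (cong (_*ᶻ evalM Q (β t)) (ℤ.+-inverseʳ (T p))))
    evalM-mulRange p (suc c) Q p+c<n = begin
      evalM (mulVar p Q ++ mulRange (suc p) c Q) (β t)
        ≡⟨ evalM-++ (β t) (mulVar p Q) (mulRange (suc p) c Q) ⟩
      evalM (mulVar p Q) (β t) +ᶻ evalM (mulRange (suc p) c Q) (β t)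
        ≡⟨ cong₂ _+ᶻ_ (evalM-mulVar (β t) (λ l → T l -ᶻ T (suc l)) β≡T-diff p<n Q)
                      (evalM-mulRange (suc p) c Q (ℕ.≤-trans (ℕ.≤-reflexive (sym (ℕ.+-suc p c))) p+c<n)) ⟩
      (T p -ᶻ T (suc p)) *ᶻ e +ᶻ (T (suc p) -ᶻ T (suc p + c)) *ᶻ e
        ≡⟨ telescope (T p) (T (suc p)) (T (suc p + c)) e ⟩
      (T p -ᶻ T (suc p + c)) *ᶻ e
        ≡⟨ cong (λ l → (T p -ᶻ T l) *ᶻ e) (ℕ.+-suc p c) ⟨
      (T p -ᶻ T (p + suc c)) *ᶻ e ∎
      where
      open ≡-Reasoning
      e = evalM Q (β t)
      p<n : p < n
      p<n = ℕ.≤-trans (s≤s (ℕ.m≤m+n p c)) (ℕ.≤-trans (ℕ.≤-reflexive (sym (ℕ.+-suc p c))) p+c<n)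
      telescope : ∀ a b c e → (a -ᶻ b) *ᶻ e +ᶻ (b -ᶻ c) *ᶻ e ≡ (a -ᶻ c) *ᶻ e
      telescope = solve-∀

    σ-act-δⱼ-vanishesBelow : ∀ a → σ-act a (δ j) VanishesBelow j
    σ-act-δⱼ-vanishesBelow a = σ-act-vanishesBelow a (δ-vanishesBelow j)

    evalM-mulRange-coeffPoly : ∀ {a k} → a < j → suc k ≤ n → ∀ Q → evalM Q (β t) ≡ σ-act a (δ j) (suc k) →
      evalM (mulRange a (suc k ∸ a) Q) (β t) ≡ (T a -ᶻ T (suc k)) *ᶻ σ-act a (δ j) (suc k)
    evalM-mulRange-coeffPoly {a} {k} a<j k<n Q Q≡W with a ℕ.≤? suc k
    ... | yes a≤k+1 = begin
      evalM (mulRange a (suc k ∸ a) Q) (β t)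
        ≡⟨ evalM-mulRange a (suc k ∸ a) Q (ℕ.≤-trans (ℕ.≤-reflexive a+[k+1-a]≡k+1) k<n) ⟩
      (T a -ᶻ T (a + (suc k ∸ a))) *ᶻ evalM Q (β t)
        ≡⟨ cong₂ (λ l e → (T a -ᶻ T l) *ᶻ e) a+[k+1-a]≡k+1 Q≡W ⟩
      (T a -ᶻ T (suc k)) *ᶻ σ-act a (δ j) (suc k) ∎
      where
      open ≡-Reasoning
      a+[k+1-a]≡k+1 = ℕ.m+[n∸m]≡n a≤k+1
    ... | no a≰k+1 = begin
      evalM (mulRange a (suc k ∸ a) Q) (β t)
        ≡⟨ cong (λ c → evalM (mulRange a c Q) (β t)) (ℕ.m≤n⇒m∸n≡0 (ℕ.<⇒≤ k+1<a)) ⟩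
      + 0
        ≡⟨ ℤ.*-zeroʳ (T a -ᶻ T (suc k)) ⟨
      (T a -ᶻ T (suc k)) *ᶻ + 0
        ≡⟨ cong ((T a -ᶻ T (suc k)) *ᶻ_) (σ-act-δⱼ-vanishesBelow a (ℕ.<-trans k+1<a a<j)) ⟨
      (T a -ᶻ T (suc k)) *ᶻ σ-act a (δ j) (suc k) ∎
      where
      open ≡-Reasoning
      k+1<a = ℕ.≰⇒> a≰k+1

    evalM-coeffPoly : ∀ {a} → a ≤ j → ∀ {k} → k ≤ n → evalM (coeffPoly a k) (β t) ≡ σ-act a (δ j) k
    evalM-coeffPoly {zero}  _   {k}     _ = evalM-δᴾ (β t) j k
    evalM-coeffPoly {suc a} a<j {zero}  _ = sym (begin
      act (ζ+ T a) (σ-act a (δ j)) zero        ≡⟨ act-ζ+-zero (T a) (σ-act a (δ j)) ⟩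
      (T a -ᶻ T zero) *ᶻ σ-act a (δ j) zero    ≡⟨ cong ((T a -ᶻ T zero) *ᶻ_) (σ-act-δⱼ-vanishesBelow a (ℕ.≤-<-trans z≤n a<j)) ⟩
      (T a -ᶻ T zero) *ᶻ + 0                   ≡⟨ ℤ.*-zeroʳ (T a -ᶻ T zero) ⟩
      + 0                                      ∎)
      where open ≡-Reasoning
    evalM-coeffPoly {suc a} a<j {suc k} k<n = begin
      evalM (coeffPoly a k ++ mulRange a (suc k ∸ a) (coeffPoly a (suc k))) (β t)
        ≡⟨ evalM-++ (β t) (coeffPoly a k) _ ⟩
      evalM (coeffPoly a k) (β t) +ᶻ evalM (mulRange a (suc k ∸ a) (coeffPoly a (suc k))) (β t)
        ≡⟨ cong₂ _+ᶻ_ (evalM-coeffPoly (ℕ.<⇒≤ a<j) (ℕ.<⇒≤ k<n))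
                      (evalM-mulRange-coeffPoly a<j k<n _ (evalM-coeffPoly (ℕ.<⇒≤ a<j) k<n)) ⟩
      σ-act a (δ j) k +ᶻ (T a -ᶻ T (suc k)) *ᶻ σ-act a (δ j) (suc k)
        ≡⟨ act-ζ+-suc (T a) (σ-act a (δ j)) k ⟨
      σ-act (suc a) (δ j) (suc k) ∎
      where open ≡-Reasoning

  coeffSum-δᴾ-diag : ∀ a → coeffSum (δᴾ a a) ≡ 1
  coeffSum-δᴾ-diag zero    = refl
  coeffSum-δᴾ-diag (suc a) = coeffSum-δᴾ-diag a

  coeffSum-δᴾ-off : ∀ {a k} → a ≢ k → coeffSum (δᴾ a k) ≡ 0
  coeffSum-δᴾ-off {zero}  {zero}  a≢k = contradiction refl a≢k
  coeffSum-δᴾ-off {zero}  {suc k} _   = refl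
  coeffSum-δᴾ-off {suc a} {zero}  _   = refl
  coeffSum-δᴾ-off {suc a} {suc k} a≢k = coeffSum-δᴾ-off (a≢k ∘ cong suc)

  coeffSum-coeffPoly-suc : ∀ a k → coeffSum (coeffPoly (suc a) (suc k))
                                   ≡ coeffSum (coeffPoly a k) + (suc k ∸ a) * coeffSum (coeffPoly a (suc k))
  coeffSum-coeffPoly-suc a k =
    trans (coeffSum-++ (coeffPoly a k) _) (cong (_+_ (coeffSum (coeffPoly a k))) (coeffSum-mulRange a (suc k ∸ a) _))

  coeffSum-coeffPoly-above : ∀ a {k} → a + j < k → coeffSum (coeffPoly a k) ≡ 0
  coeffSum-coeffPoly-above zero    {k}     j<k              = coeffSum-δᴾ-off (ℕ.<⇒≢ j<k)
  coeffSum-coeffPoly-above (suc a) {zero}  _                = refl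
  coeffSum-coeffPoly-above (suc a) {suc k} (s≤s a+j<k) = begin
    coeffSum (coeffPoly (suc a) (suc k))
      ≡⟨ coeffSum-coeffPoly-suc a k ⟩
    coeffSum (coeffPoly a k) + (suc k ∸ a) * coeffSum (coeffPoly a (suc k))
      ≡⟨ cong₂ (λ x y → x + (suc k ∸ a) * y)
               (coeffSum-coeffPoly-above a a+j<k) (coeffSum-coeffPoly-above a (ℕ.m<n⇒m<1+n a+j<k)) ⟩
    (suc k ∸ a) * 0
      ≡⟨ ℕ.*-zeroʳ (suc k ∸ a) ⟩
    0 ∎
    where open ≡-Reasoning

  termCount : ℕ → ℕ → ℕ
  termCount a r = r ! * (a C r) * (j C r)

  termCount-suc : ∀ a s → termCount a (suc s) + (j ∸ s) * termCount a s ≡ termCount (suc a) (suc s)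
  termCount-suc a s = begin
    termCount a (suc s) + (j ∸ s) * termCount a s
      ≡⟨ cong (_+_ (termCount a (suc s))) (shuffle (j ∸ s) (s !) (a C s) (j C s)) ⟩
    termCount a (suc s) + s ! * (a C s) * ((j ∸ s) * (j C s))
      ≡⟨ cong (λ y → termCount a (suc s) + s ! * (a C s) * y) ([1+k]*nC[1+k]≡[n∸k]*nCk j s) ⟨
    termCount a (suc s) + s ! * (a C s) * (suc s * (j C suc s))
      ≡⟨ collect s (s !) (a C s) (a C suc s) (j C suc s) ⟩
    suc s ! * (a C s + a C suc s) * (j C suc s)
      ≡⟨ cong (λ c → suc s ! * c * (j C suc s)) (Binomial.nCk+nC[k+1]≡[n+1]C[k+1] a s) ⟩
    termCount (suc a) (suc s) ∎
    where
    open ≡-Reasoning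
    shuffle : ∀ d f x y → d * (f * x * y) ≡ f * x * (d * y)
    shuffle = ℕ-solve-∀
    collect : ∀ s f x x′ y′ → suc s * f * x′ * y′ + f * x * (suc s * y′) ≡ suc s * f * (x + x′) * y′
    collect = ℕ-solve-∀

  coeffSum-δᴾ-termCount : ∀ k r → k + r ≡ j → coeffSum (δᴾ j k) ≡ termCount 0 r
  coeffSum-δᴾ-termCount k zero    k≡j     = trans (cong (coeffSum ∘ δᴾ j) (trans (sym (ℕ.+-identityʳ k)) k≡j))
                                                  (coeffSum-δᴾ-diag j)
  coeffSum-δᴾ-termCount k (suc r) k+r+1≡j =
    trans (coeffSum-δᴾ-off (ℕ.>⇒≢ (subst (k <_) k+r+1≡j (ℕ.m<m+n k (s≤s z≤n)))))
          (sym (cong (_* (j C suc r)) (ℕ.*-zeroʳ (suc r !))))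

  coeffSum-coeffPoly : ∀ a k r → k + r ≡ a + j → coeffSum (coeffPoly a k) ≡ termCount a r
  coeffSum-coeffPoly zero    k       r       k+r≡j = coeffSum-δᴾ-termCount k r k+r≡j
  coeffSum-coeffPoly (suc a) zero    r       r≡a+1+j =
    sym (trans (cong (r ! * (suc a C r) *_) (Binomial.k>n⇒nCk≡0 j<r)) (ℕ.*-zeroʳ (r ! * (suc a C r))))
    where
    j<r : j < r
    j<r = subst (j <_) (sym r≡a+1+j) (s≤s (ℕ.m≤n+m j a))
  coeffSum-coeffPoly (suc a) (suc k) zero    k+1≡a+1+j = begin
    coeffSum (coeffPoly (suc a) (suc k))
      ≡⟨ coeffSum-coeffPoly-suc a k ⟩
    coeffSum (coeffPoly a k) + (suc k ∸ a) * coeffSum (coeffPoly a (suc k))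
      ≡⟨ cong₂ (λ x y → x + (suc k ∸ a) * y) (coeffSum-coeffPoly a k zero k≡a+j)
               (coeffSum-coeffPoly-above a (s≤s (ℕ.≤-reflexive (sym (trans (sym (ℕ.+-identityʳ k)) k≡a+j))))) ⟩
    termCount a zero + (suc k ∸ a) * 0
      ≡⟨ cong (_+_ (termCount a zero)) (ℕ.*-zeroʳ (suc k ∸ a)) ⟩
    termCount (suc a) zero ∎
    where
    open ≡-Reasoning
    k≡a+j = ℕ.suc-injective k+1≡a+1+j
  -- suc k ∸ a ≡ j ∸ s holds also when a > suc k: then both truncate to 0.
  coeffSum-coeffPoly (suc a) (suc k) (suc s) k+s+2≡a+1+j = begin
    coeffSum (coeffPoly (suc a) (suc k))
      ≡⟨ coeffSum-coeffPoly-suc a k ⟩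
    coeffSum (coeffPoly a k) + (suc k ∸ a) * coeffSum (coeffPoly a (suc k))
      ≡⟨ cong₂ (λ x y → x + (suc k ∸ a) * y) (coeffSum-coeffPoly a k (suc s) k+s+1≡a+j)
                                               (coeffSum-coeffPoly a (suc k) s k+1+s≡a+j) ⟩
    termCount a (suc s) + (suc k ∸ a) * termCount a s
      ≡⟨ cong (λ d → termCount a (suc s) + d * termCount a s) (m+n≡o+p⇒m∸o≡p∸n {suc k} {s} {a} {j} k+1+s≡a+j) ⟩
    termCount a (suc s) + (j ∸ s) * termCount a s
      ≡⟨ termCount-suc a s ⟩
    termCount (suc a) (suc s) ∎
    where
    open ≡-Reasoning
    k+s+1≡a+j = ℕ.suc-injective k+s+2≡a+1+j
    k+1+s≡a+j = trans (sym (ℕ.+-suc k s)) k+s+1≡a+j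

CoefficientExpansion : ℕ → ℕ → ℕ → ℕ → Set
CoefficientExpansion n a b k =
  Σ (MPolyℕ n) λ P → (∀ t → σ-Coordinates.act t (σ t a ⊛ σ t b) (δ 0) k ≡ evalM P (β t))
                   × coeffSum P ≡ (a + b ∸ k) ! * (a C (a + b ∸ k)) * (b C (a + b ∸ k))

σ-product-expansion-≤ : ∀ {n} a b k → a ≤ b → b ≤ n → k ≤ n → k ≤ a + b → CoefficientExpansion n a b k
σ-product-expansion-≤ {n} a b k a≤b b≤n k≤n k≤a+b =
  coeffPoly a k , evaluation , coeffSum-coeffPoly a k (a + b ∸ k) (ℕ.m+[n∸m]≡n k≤a+b)
  where
  open Expansion n b
  evaluation : ∀ t → σ-Coordinates.act t (σ t a ⊛ σ t b) (δ 0) k ≡ evalM (coeffPoly a k) (β t)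
  evaluation t = begin
    act (σ t a ⊛ σ t b) (δ 0) k        ≡⟨ act-⊛ (σ t a) (σ t b) (δ 0) k ⟩
    act (σ t a) (act (σ t b) (δ 0)) k  ≡⟨ act-cong (σ t a) (act-σ-δ₀ (ℕ.m≤n⇒m≤1+n b≤n)) k ⟩
    act (σ t a) (δ b) k                ≡⟨ act-σ (ℕ.m≤n⇒m≤1+n (ℕ.≤-trans a≤b b≤n)) (δ b) k ⟩
    σ-act a (δ b) k                    ≡⟨ evalM-coeffPoly t a≤b k≤n ⟨
    evalM (coeffPoly a k) (β t)        ∎
    where
    open ≡-Reasoning
    open σ-Coordinates t

σ-product-expansion : ∀ {n} a b k → a ≤ n → b ≤ n → k ≤ n → k ≤ a + b → CoefficientExpansion n a b k
σ-product-expansion a b k a≤n b≤n k≤n k≤a+b with ℕ.≤-total a b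
... | inj₁ a≤b = σ-product-expansion-≤ a b k a≤b b≤n k≤n k≤a+b
... | inj₂ b≤a =
  let P , evaluation , count = σ-product-expansion-≤ b a k b≤a a≤n k≤n (subst (k ≤_) (ℕ.+-comm a b) k≤a+b)
  in P , (λ t → trans (σ-Coordinates.act-⊛-comm t (σ t a) (σ t b) (δ 0) k) (evaluation t)) , trans count swap
  where
  r = a + b ∸ k
  swap : (b + a ∸ k) ! * (b C (b + a ∸ k)) * (a C (b + a ∸ k)) ≡ r ! * (a C r) * (b C r)
  swap = trans (cong (λ m → m ! * (b C m) * (a C m)) (cong (_∸ k) (ℕ.+-comm b a)))
               (exchange (r !) (b C r) (a C r))
    where
    exchange : ∀ x y z → x * y * z ≡ x * z * y
    exchange = ℕ-solve-∀

corollary3p5 : (n : ℕ) → 1 ≤ n → (i j : Fin (suc n))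
  → (c : Fin (suc n) → (Fin (suc n) → ℤ) → ℤ)
  → (∀ (t : Fin (suc n) → ℤ) → (σ t (toℕ i) ⊛ σ t (toℕ j)) ≡ sumP (λ k → scale (c k t) (σ t (toℕ k))) [mod rel t ])
  → (k : Fin (suc n)) → toℕ k ≤ toℕ i + toℕ j
  → Σ (MPolyℕ n) (λ P → (∀ (t : Fin (suc n) → ℤ) → c k t ≡ evalM P (β t))
      × coeffSum P ≡ ((toℕ i + toℕ j ∸ toℕ k) !) * ((toℕ i) C (toℕ i + toℕ j ∸ toℕ k)) * ((toℕ j) C (toℕ i + toℕ j ∸ toℕ k)))
corollary3p5 n _ i j c congruence k k≤i+j =
  let P , evaluation , count = σ-product-expansion (toℕ i) (toℕ j) (toℕ k)
                                 (Fin.toℕ≤pred[n] i) (Fin.toℕ≤pred[n] j) (Fin.toℕ≤pred[n] k) k≤i+j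
  in P , (λ t → trans (coordinate t) (evaluation t)) , count
  where
  coordinate : ∀ t → c k t ≡ σ-Coordinates.act t (σ t (toℕ i) ⊛ σ t (toℕ j)) (δ 0) (toℕ k)
  coordinate t = σ-Coordinates.σ-coordinate t (σ t (toℕ i) ⊛ σ t (toℕ j)) (λ l → c l t) (congruence t) k
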